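{- Let $b\ge2$ and $N\ge0$ be integers, and let $\{s_n(x)\}$ be a Sheffer polynomial sequence with associated sequence $\{p_n(x)\}$. With the matrices $S_{b,N}$, $P_{b,N}$ defined below, for $\mathbf{x}_N=(x_0,\dots,x_{N-1})$, $\mathbf{y}_N=(y_0,\dots,y_{N-1})$ and $\mathbf{x}_N+\mathbf{y}_N=(x_0+y_0,\dots,x_{N-1}+y_{N-1})$, \[ P_{b,N}(\mathbf{x}_N)S_{b,N}(\mathbf{y}_N)=S_{b,N}(\mathbf{x}_N+\mathbf{y}_N)\quad\text{and}\quad P_{b,N}(\mathbf{x}_N)P_{b,N}(\mathbf{y}_N)=P_{b,N}(\mathbf{x}_N+\mathbf{y}_N). \]
   Context: Sheffer sequences: let $f(t)=\sum_{k\ge0}a_kt^k$ with $a_0=0,a_1\ne0$, $g(t)=\sum_{k\ge0}b_kt^k$ with $b_0\ne0$, $\bar f$ the compositional inverse of $f$; $s_n(x)$ is defined by $\frac{1}{g(\bar f(t))}e^{x\bar f(t)}=\sum_{n\ge0}\frac{s_n(x)}{n!}t^n$ and its associated sequence $p_n(x)$ by $e^{x\bar f(t)}=\sum_{n\ge0}\frac{p_n(x)}{n!}t^n$. Put $\bar s_k=s_k/k!$, $\bar p_k=p_k/k!$. For non-negative integers $k,j$, $k\preceq_b j$ means every base-$b$ digit of $k$ is at most the corresponding digit of $j$. Set $S_{b,0}=P_{b,0}=1$ (the $1\times1$ matrix). For $N>0$, $S_{b,N}(\mathbf{x}_N)$ and $P_{b,N}(\mathbf{x}_N)$ are the $b^N\times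 b^N$ matrices with rows and columns indexed by $0,\dots,b^N-1$, whose $(j,k)$ entries are respectively $\prod_{i=0}^{N-1}\bar s_{d_i}(x_i)$ and $\prod_{i=0}^{N-1}\bar p_{d_i}(x_i)$ if $0\le k\le j\le b^N-1$ and $k\preceq_b j$, and $0$ otherwise, where $j-k=d_0b^0+\cdots+d_{N-1}b^{N-1}$ is the base-$b$ expansion of $j-k$. -}

module Defs where

open import Level using (Level; _⊔_) renaming (suc to lsuc)
open import Algebra.Bundles using (CommutativeRing)
open import Data.Nat as ℕ using (ℕ; zero; suc; _∸_; NonZero; _!)
open import Data.Nat.Properties using (_!≢0)
open import Data.Nat.DivMod using (_/_; _%_)
open import Data.Fin using (Fin; toℕ)
open import Data.Fin.Properties using (all?)
open import Data.Product using (Σ; proj₁; _×_)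
open import Relation.Nullary using (¬_; Dec; yes; no; _×-dec_)
open import Relation.Binary.PropositionalEquality using (_≡_)

natC : {c ℓ : Level} (R : CommutativeRing c ℓ) → ℕ → CommutativeRing.Carrier R
natC R zero    = CommutativeRing.0# R
natC R (suc n) = CommutativeRing._+_ R (CommutativeRing.1# R) (natC R n)

record CharZeroField (c ℓ : Level) : Set (lsuc (c ⊔ ℓ)) where
  field
    cring : CommutativeRing c ℓ
  open CommutativeRing cring public
  field
    1≉0      : ¬ (1# ≈ 0#)
    inverse  : (x : Carrier) → ¬ (x ≈ 0#) → Σ Carrier (λ y → (x * y) ≈ 1#)
    charZero : (n : ℕ) → .{{NonZero n}} → ¬ (natC cring n ≈ 0#)

module Sheffer {c ℓ : Level} (K : CharZeroField c ℓ) where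
  open CharZeroField K using (Carrier; _≈_; _+_; _*_; 0#; 1#; inverse; charZero; cring)

  Series : Set c
  Series = ℕ → Carrier

  sumTo : ℕ → (ℕ → Carrier) → Carrier
  sumTo zero    h = h zero
  sumTo (suc n) h = sumTo n h + h (suc n)

  prodFin : (n : ℕ) → (Fin n → Carrier) → Carrier
  prodFin zero    h = 1#
  prodFin (suc n) h = h Fin.zero * prodFin n (λ i → h (Fin.suc i))

  powC : Carrier → ℕ → Carrier
  powC x zero    = 1#
  powC x (suc m) = x * powC x m

  oneS : Series
  oneS zero    = 1#
  oneS (suc n) = 0#

  tS : Series
  tS zero          = 0#
  tS (suc zero)    = 1#
  tS (suc (suc n)) = 0#

  _⊛_ : Series → Series → Series
  (A ⊛ B) n = sumTo n (λ i → A i * B (n ∸ i))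

  powS : Series → ℕ → Series
  powS A zero    = oneS
  powS A (suc m) = A ⊛ powS A m

  -- composition A(U(t)) (meaningful when U 0 = 0: coefficient n only needs m ≤ n)
  _∘S_ : Series → Series → Series
  (A ∘S U) n = sumTo n (λ m → A m * powS U m n)

  invFact : ℕ → Carrier
  invFact m = proj₁ (inverse (natC cring (m !)) (charZero (m !) {{m !≢0}}))

  -- coefficient of t^n in  e^{x U(t)} = Σ_m x^m U(t)^m / m!   (U 0 = 0)
  expCoeff : Series → Carrier → Series
  expCoeff U x n = sumTo n (λ m → (powC x m) * (invFact m * powS U m n))

  record ShefferData : Set (c ⊔ ℓ) where
    field
      f g fbar G : Series
      f0       : f 0 ≈ 0#
      f1≉0     : ¬ (f 1 ≈ 0#)
      g0≉0     : ¬ (g 0 ≈ 0#)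
      fbar0    : fbar 0 ≈ 0#
      f∘fbar   : ∀ n → (f ∘S fbar) n ≈ tS n
      fbar∘f   : ∀ n → (fbar ∘S f) n ≈ tS n
      G-recip  : ∀ n → (G ⊛ (g ∘S fbar)) n ≈ oneS n

    -- s̄_n(x) = s_n(x)/n! = [t^n] (1/g(fbar t)) e^{x fbar(t)}
    sbar : ℕ → Carrier → Carrier
    sbar n x = (G ⊛ expCoeff fbar x) n

    -- p̄_n(x) = p_n(x)/n! = [t^n] e^{x fbar(t)}
    pbar : ℕ → Carrier → Carrier
    pbar n x = expCoeff fbar x n

  digit : (b : ℕ) → .{{NonZero b}} → ℕ → ℕ → ℕ
  digit b zero    n = n % b
  digit b (suc i) n = digit b i (n / b)

  -- k ⪯_b j on the digits of index < N (for j, k < b^N these are all the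
  -- nonzero digits, so this is exactly the paper's k ⪯_b j)
  Prec : (b : ℕ) → .{{NonZero b}} → (N k j : ℕ) → Set
  Prec b N k j = (i : Fin N) → digit b (toℕ i) k ℕ.≤ digit b (toℕ i) j

  Prec? : (b : ℕ) → .{{_ : NonZero b}} → (N k j : ℕ) → Dec (Prec b N k j)
  Prec? b N k j = all? {n = N} (λ i → digit b (toℕ i) k ℕ.≤? digit b (toℕ i) j)

  Mat : ℕ → Set c
  Mat m = Fin m → Fin m → Carrier

  digitMat : (b : ℕ) → .{{NonZero b}} → (N : ℕ) →
             (ℕ → Carrier → Carrier) → (Fin N → Carrier) → Mat (b ℕ.^ N)
  digitMat b N q x j k with (toℕ k ℕ.≤? toℕ j) ×-dec Prec? b N (toℕ k) (toℕ j)
  ... | yes _ = prodFin N (λ i → q (digit b (toℕ i) (toℕ j ∸ toℕ k)) (x i))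
  ... | no  _ = 0#

  SMat : (D : ShefferData) (b : ℕ) → .{{NonZero b}} → (N : ℕ) → (Fin N → Carrier) → Mat (b ℕ.^ N)
  SMat D b N = digitMat b N (ShefferData.sbar D)

  PMat : (D : ShefferData) (b : ℕ) → .{{NonZero b}} → (N : ℕ) → (Fin N → Carrier) → Mat (b ℕ.^ N)
  PMat D b N = digitMat b N (ShefferData.pbar D)

  _⊠_ : {m : ℕ} → Mat m → Mat m → Mat m
  _⊠_ {m} A B j k = sumFin m (λ l → A j l * B l k)
    where
      sumFin : (n : ℕ) → (Fin n → Carrier) → Carrier
      sumFin zero    h = 0#
      sumFin (suc n) h = h Fin.zero + sumFin n (λ i → h (Fin.suc i))

  _≈M_ : {m : ℕ} → Mat m → Mat m → Set ℓ
  A ≈M B = ∀ j k → A j k ≈ B j k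

  _+V_ : {N : ℕ} → (Fin N → Carrier) → (Fin N → Carrier) → (Fin N → Carrier)
  (x +V y) i = x i + y i

-- The exponential law e^{(x+y) f̄(t)} = e^{x f̄(t)} e^{y f̄(t)} says that p̄_n(x+y) is the
-- convolution Σ_i p̄_i(x) p̄_{n-i}(y); multiplying by 1/g(f̄(t)) gives likewise
-- s̄_n(x+y) = Σ_i p̄_i(x) s̄_{n-i}(y). For N = 1 such an identity is exactly the product rule
-- for the b×b lower triangular Toeplitz matrices (q_{j-k}(x))_{j,k}. For general N the digit
-- matrix is the Kronecker product of N of these Toeplitz matrices, one per base-b digit: when
-- k ⪯_b j the subtraction j - k involves no borrow, so its digits are the differences of the
-- digits of j and k. Kronecker products multiply factorwise, which reduces everything to N = 1.

{-# OPTIONS --safe #-}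
module Submission where

open import Defs
open import Level using (Level; _⊔_)
open import Data.Nat using (ℕ; _≤_; NonZero)
open import Data.Fin using (Fin)
open import Data.Product using (_×_)

import Algebra.Properties.CommutativeSemigroup as CommutativeSemigroupProperties
import Algebra.Properties.CommutativeSemiring.Binomial as Binomial
import Algebra.Properties.Semiring.Exp as Exp
import Algebra.Properties.Semiring.Mult as Mult
import Algebra.Definitions.RawMonoid as RawMonoid
open import Data.Empty using (⊥-elim)
open import Data.Fin as Fin using (toℕ)
open import Data.Fin.Properties using (toℕ<n)
open import Data.Nat as ℕ using (zero; suc; _∸_; _<_; z≤n; s≤s; _≤?_; _!)
import Data.Nat.Properties as ℕₚ
open import Data.Nat.DivMod using (_/_; _%_)
import Data.Nat.DivMod as ℕ÷
open import Data.Nat.Combinatorics using (nCk≡n!/k![n-k]!; k![n∸k]!∣n!) renaming (_C_ to _choose_)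
import Data.Nat.Solver
open import Data.Product using (_,_; proj₂)
open import Data.Sum using (inj₁; inj₂)
open import Function using (_∘_)
open import Relation.Nullary using (¬_; Dec; yes; no; _×-dec_)
open import Relation.Binary.PropositionalEquality as ≡ using (_≡_)

module _ {c ℓ : Level} (K : CharZeroField c ℓ) where
  open CharZeroField K
  open Sheffer K
  open import Relation.Binary.Reasoning.Setoid setoid
  private
    module *-CS = CommutativeSemigroupProperties *-commutativeSemigroup

  -- Finite sums

  sumTo-cong : ∀ n {h h′ : ℕ → Carrier} → (∀ i → i ≤ n → h i ≈ h′ i) → sumTo n h ≈ sumTo n h′
  sumTo-cong zero    h≈h′ = h≈h′ 0 z≤n
  sumTo-cong (suc n) h≈h′ =
    +-cong (sumTo-cong n (λ i i≤n → h≈h′ i (ℕₚ.m≤n⇒m≤1+n i≤n))) (h≈h′ (suc n) ℕₚ.≤-refl)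

  sumTo-≈0 : ∀ n {h : ℕ → Carrier} → (∀ i → i ≤ n → h i ≈ 0#) → sumTo n h ≈ 0#
  sumTo-≈0 zero    h≈0 = h≈0 0 z≤n
  sumTo-≈0 (suc n) h≈0 =
    trans (+-cong (sumTo-≈0 n (λ i i≤n → h≈0 i (ℕₚ.m≤n⇒m≤1+n i≤n))) (h≈0 (suc n) ℕₚ.≤-refl)) (+-identityˡ 0#)

  sumTo-+ : ∀ n (h h′ : ℕ → Carrier) → sumTo n (λ i → h i + h′ i) ≈ sumTo n h + sumTo n h′
  sumTo-+ zero    h h′ = refl
  sumTo-+ (suc n) h h′ = trans (+-congʳ (sumTo-+ n h h′)) (+-CS.interchange _ _ _ _)
    where module +-CS = CommutativeSemigroupProperties +-commutativeSemigroup

  *-distribˡ-sumTo : ∀ n a (h : ℕ → Carrier) → a * sumTo n h ≈ sumTo n (λ i → a * h i)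
  *-distribˡ-sumTo zero    a h = refl
  *-distribˡ-sumTo (suc n) a h = trans (distribˡ a _ _) (+-congʳ (*-distribˡ-sumTo n a h))

  *-distribʳ-sumTo : ∀ n a (h : ℕ → Carrier) → sumTo n h * a ≈ sumTo n (λ i → h i * a)
  *-distribʳ-sumTo zero    a h = refl
  *-distribʳ-sumTo (suc n) a h = trans (distribʳ a _ _) (+-congʳ (*-distribʳ-sumTo n a h))

  sumTo-*-sumTo : ∀ n m (h h′ : ℕ → Carrier) →
    sumTo n h * sumTo m h′ ≈ sumTo n (λ i → sumTo m (λ j → h i * h′ j))
  sumTo-*-sumTo n m h h′ =
    trans (*-distribʳ-sumTo n _ h) (sumTo-cong n (λ i _ → *-distribˡ-sumTo m (h i) h′))

  sumTo-suc : ∀ n (h : ℕ → Carrier) → sumTo (suc n) h ≈ h 0 + sumTo n (h ∘ suc)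
  sumTo-suc zero    h = refl
  sumTo-suc (suc n) h = trans (+-congʳ (sumTo-suc n h)) (+-assoc _ _ _)

  sumTo-reverse : ∀ n (h : ℕ → Carrier) → sumTo n h ≈ sumTo n (λ i → h (n ∸ i))
  sumTo-reverse zero    h = refl
  sumTo-reverse (suc n) h = begin
    sumTo n h + h (suc n)                   ≈⟨ +-comm _ _ ⟩
    h (suc n) + sumTo n h                   ≈⟨ +-congˡ (sumTo-reverse n h) ⟩
    h (suc n) + sumTo n (λ i → h (n ∸ i))   ≈⟨ sym (sumTo-suc n (λ i → h (suc n ∸ i))) ⟩
    sumTo (suc n) (λ i → h (suc n ∸ i))     ∎

  sumTo-swap : ∀ n m (h : ℕ → ℕ → Carrier) →
    sumTo n (λ i → sumTo m (h i)) ≈ sumTo m (λ j → sumTo n (λ i → h i j))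
  sumTo-swap zero    m h = refl
  sumTo-swap (suc n) m h =
    trans (+-congʳ (sumTo-swap n m h)) (sym (sumTo-+ m (λ j → sumTo n (λ i → h i j)) (h (suc n))))

  sumTo-extend : ∀ m n (h : ℕ → Carrier) → m ≤ n → (∀ i → m < i → i ≤ n → h i ≈ 0#) →
    sumTo n h ≈ sumTo m h
  sumTo-extend m zero    h z≤n _ = refl
  sumTo-extend m (suc n) h m≤1+n h≈0 with ℕₚ.m≤n⇒m<n∨m≡n m≤1+n
  ... | inj₂ ≡.refl      = refl
  ... | inj₁ (s≤s m≤n) = begin
    sumTo n h + h (suc n) ≈⟨ +-cong (sumTo-extend m n h m≤n (λ i m<i i≤n → h≈0 i m<i (ℕₚ.m≤n⇒m≤1+n i≤n)))
                                    (h≈0 (suc n) (s≤s m≤n) ℕₚ.≤-refl) ⟩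
    sumTo m h + 0#        ≈⟨ +-identityʳ _ ⟩
    sumTo m h             ∎

  sumTo-triangle : ∀ n (h : ℕ → ℕ → Carrier) →
    sumTo n (λ m → sumTo m (λ a → h a m)) ≈ sumTo n (λ a → sumTo (n ∸ a) (λ c → h a (a ℕ.+ c)))
  sumTo-triangle zero    h = refl
  sumTo-triangle (suc n) h = begin
    sumTo n (λ m → sumTo m (λ a → h a m)) + sumTo (suc n) (λ a → h a (suc n))
      ≈⟨ +-congʳ (sumTo-triangle n h) ⟩
    sumTo n (λ a → sumTo (n ∸ a) (λ c → h a (a ℕ.+ c))) + (sumTo n (λ a → h a (suc n)) + h (suc n) (suc n))
      ≈⟨ sym (+-assoc _ _ _) ⟩
    sumTo n (λ a → sumTo (n ∸ a) (λ c → h a (a ℕ.+ c))) + sumTo n (λ a → h a (suc n)) + h (suc n) (suc n)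
      ≈⟨ +-cong (sym (sumTo-+ n _ _)) (reflexive (≡.cong (h (suc n)) (≡.sym (ℕₚ.+-identityʳ (suc n))))) ⟩
    sumTo n (λ a → sumTo (n ∸ a) (λ c → h a (a ℕ.+ c)) + h a (suc n)) + h (suc n) (suc n ℕ.+ 0)
      ≈⟨ +-cong (sumTo-cong n row)
                (reflexive (≡.cong (λ d → sumTo d (λ c → h (suc n) (suc n ℕ.+ c))) (≡.sym (ℕₚ.n∸n≡0 n)))) ⟩
    sumTo (suc n) (λ a → sumTo (suc n ∸ a) (λ c → h a (a ℕ.+ c))) ∎
    where
    row : ∀ a → a ≤ n →
      sumTo (n ∸ a) (λ c → h a (a ℕ.+ c)) + h a (suc n) ≈ sumTo (suc n ∸ a) (λ c → h a (a ℕ.+ c))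
    row a a≤n rewrite ℕₚ.+-∸-assoc 1 a≤n =
      +-congˡ (reflexive (≡.cong (h a) (≡.sym (≡.trans (ℕₚ.+-suc a (n ∸ a)) (≡.cong suc (ℕₚ.m+[n∸m]≡n a≤n))))))

  sumBelow : ℕ → (ℕ → Carrier) → Carrier
  sumBelow zero    h = 0#
  sumBelow (suc n) h = h 0 + sumBelow n (h ∘ suc)

  sumBelow-cong : ∀ n {h h′ : ℕ → Carrier} → (∀ i → i < n → h i ≈ h′ i) → sumBelow n h ≈ sumBelow n h′
  sumBelow-cong zero    h≈h′ = refl
  sumBelow-cong (suc n) h≈h′ = +-cong (h≈h′ 0 (s≤s z≤n)) (sumBelow-cong n (λ i i<n → h≈h′ (suc i) (s≤s i<n)))

  sumBelow-≈0 : ∀ n {h : ℕ → Carrier} → (∀ i → i < n → h i ≈ 0#) → sumBelow n h ≈ 0#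
  sumBelow-≈0 zero    h≈0 = refl
  sumBelow-≈0 (suc n) h≈0 =
    trans (+-cong (h≈0 0 (s≤s z≤n)) (sumBelow-≈0 n (λ i i<n → h≈0 (suc i) (s≤s i<n)))) (+-identityˡ 0#)

  sumBelow-split : ∀ m n (h : ℕ → Carrier) → sumBelow (m ℕ.+ n) h ≈ sumBelow m h + sumBelow n (λ i → h (m ℕ.+ i))
  sumBelow-split zero    n h = sym (+-identityˡ _)
  sumBelow-split (suc m) n h = trans (+-congˡ (sumBelow-split m n (h ∘ suc))) (sym (+-assoc _ _ _))

  *-distribˡ-sumBelow : ∀ n a (h : ℕ → Carrier) → a * sumBelow n h ≈ sumBelow n (λ i → a * h i)
  *-distribˡ-sumBelow zero    a h = zeroʳ a
  *-distribˡ-sumBelow (suc n) a h = trans (distribˡ a _ _) (+-congˡ (*-distribˡ-sumBelow n a (h ∘ suc)))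

  *-distribʳ-sumBelow : ∀ n a (h : ℕ → Carrier) → sumBelow n h * a ≈ sumBelow n (λ i → h i * a)
  *-distribʳ-sumBelow zero    a h = zeroˡ a
  *-distribʳ-sumBelow (suc n) a h = trans (distribʳ a _ _) (+-congˡ (*-distribʳ-sumBelow n a (h ∘ suc)))

  sumBelow-suc≈sumTo : ∀ n (h : ℕ → Carrier) → sumBelow (suc n) h ≈ sumTo n h
  sumBelow-suc≈sumTo zero    h = +-identityʳ _
  sumBelow-suc≈sumTo (suc n) h = trans (+-congˡ (sumBelow-suc≈sumTo n (h ∘ suc))) (sym (sumTo-suc n h))

  sumBelow-truncate : ∀ m n {h : ℕ → Carrier} → m ≤ n → (∀ i → m ≤ i → h i ≈ 0#) → sumBelow n h ≈ sumBelow m h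
  sumBelow-truncate zero    n       _         h≈0 = sumBelow-≈0 n (λ i _ → h≈0 i z≤n)
  sumBelow-truncate (suc m) (suc n) (s≤s m≤n) h≈0 = +-congˡ (sumBelow-truncate m n m≤n (λ i m≤i → h≈0 (suc i) (s≤s m≤i)))

  sumBelow-window : ∀ n k j {h : ℕ → Carrier} → k ≤ j → j < n →
    (∀ i → i < k → h i ≈ 0#) → (∀ i → j < i → h i ≈ 0#) →
    sumBelow n h ≈ sumTo (j ∸ k) (λ i → h (k ℕ.+ i))
  sumBelow-window n zero j _ j<n _ h≈0 =
    trans (sumBelow-truncate (suc j) n j<n h≈0) (sumBelow-suc≈sumTo j _)
  sumBelow-window (suc n) (suc k) (suc j) (s≤s k≤j) (s≤s j<n) h≈0ˡ h≈0ʳ =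
    trans (+-cong (h≈0ˡ 0 (s≤s z≤n))
                  (sumBelow-window n k j k≤j j<n (λ i i<k → h≈0ˡ (suc i) (s≤s i<k)) (λ i j<i → h≈0ʳ (suc i) (s≤s j<i))))
          (+-identityˡ _)

  sumBelow-* : ∀ m b (h : ℕ → Carrier) →
    sumBelow (m ℕ.* b) h ≈ sumBelow m (λ i → sumBelow b (λ r → h (r ℕ.+ i ℕ.* b)))
  sumBelow-* zero    b h = refl
  sumBelow-* (suc m) b h = begin
    sumBelow (b ℕ.+ m ℕ.* b) h
      ≈⟨ sumBelow-split b (m ℕ.* b) h ⟩
    sumBelow b h + sumBelow (m ℕ.* b) (λ l → h (b ℕ.+ l))
      ≈⟨ +-cong (sumBelow-cong b (λ r _ → reflexive (≡.cong h (≡.sym (ℕₚ.+-identityʳ r)))))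
                (sumBelow-* m b (λ l → h (b ℕ.+ l))) ⟩
    sumBelow b (λ r → h (r ℕ.+ 0)) + sumBelow m (λ i → sumBelow b (λ r → h (b ℕ.+ (r ℕ.+ i ℕ.* b))))
      ≈⟨ +-congˡ (sumBelow-cong m (λ i _ → sumBelow-cong b (λ r _ →
           reflexive (≡.cong h (+-CSℕ.x∙yz≈y∙xz b r (i ℕ.* b)))))) ⟩
    sumBelow (suc m) (λ i → sumBelow b (λ r → h (r ℕ.+ i ℕ.* b))) ∎
    where module +-CSℕ = CommutativeSemigroupProperties ℕₚ.+-commutativeSemigroup

  ⊠≈sumBelow : ∀ m (A B : Mat m) j k (h : ℕ → Carrier) → (∀ l → A j l * B l k ≈ h (toℕ l)) →
    (A ⊠ B) j k ≈ sumBelow m h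
  ⊠≈sumBelow zero          A B j k h eq = refl
  ⊠≈sumBelow (suc zero)    A B j k h eq = +-congʳ (eq Fin.zero)
  ⊠≈sumBelow (suc (suc m)) A B j k h eq =
    +-cong (eq Fin.zero) (⊠≈sumBelow (suc m) (λ _ l → A j (Fin.suc l)) (λ l _ → B (Fin.suc l) k)
                                      Fin.zero Fin.zero (h ∘ suc) (eq ∘ Fin.suc))

  -- Power series

  ⊛-cong : ∀ {A A′ B B′ : Series} → (∀ n → A n ≈ A′ n) → (∀ n → B n ≈ B′ n) →
           ∀ n → (A ⊛ B) n ≈ (A′ ⊛ B′) n
  ⊛-cong A≈A′ B≈B′ n = sumTo-cong n (λ i _ → *-cong (A≈A′ i) (B≈B′ (n ∸ i)))

  ⊛-comm : ∀ (A B : Series) n → (A ⊛ B) n ≈ (B ⊛ A) n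
  ⊛-comm A B n = trans (sumTo-reverse n _) (sumTo-cong n (λ i i≤n →
    trans (*-comm _ _) (*-congʳ (reflexive (≡.cong B (ℕₚ.m∸[m∸n]≡n i≤n))))))

  ⊛-assoc : ∀ (A B C : Series) n → ((A ⊛ B) ⊛ C) n ≈ (A ⊛ (B ⊛ C)) n
  ⊛-assoc A B C n = begin
    sumTo n (λ m → sumTo m (λ a → A a * B (m ∸ a)) * C (n ∸ m))
      ≈⟨ sumTo-cong n (λ m _ → *-distribʳ-sumTo m _ _) ⟩
    sumTo n (λ m → sumTo m (λ a → A a * B (m ∸ a) * C (n ∸ m)))
      ≈⟨ sumTo-triangle n (λ a m → A a * B (m ∸ a) * C (n ∸ m)) ⟩
    sumTo n (λ a → sumTo (n ∸ a) (λ c → A a * B (a ℕ.+ c ∸ a) * C (n ∸ (a ℕ.+ c))))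
      ≈⟨ sumTo-cong n (λ a _ → sumTo-cong (n ∸ a) (λ c _ →
           trans (*-cong (*-congˡ (reflexive (≡.cong B (ℕₚ.m+n∸m≡n a c))))
                         (reflexive (≡.cong C (≡.sym (ℕₚ.∸-+-assoc n a c)))))
                 (*-assoc _ _ _))) ⟩
    sumTo n (λ a → sumTo (n ∸ a) (λ c → A a * (B c * C (n ∸ a ∸ c))))
      ≈⟨ sumTo-cong n (λ a _ → sym (*-distribˡ-sumTo (n ∸ a) _ _)) ⟩
    sumTo n (λ a → A a * sumTo (n ∸ a) (λ c → B c * C (n ∸ a ∸ c))) ∎

  ⊛-identityˡ : ∀ (B : Series) n → (oneS ⊛ B) n ≈ B n
  ⊛-identityˡ B zero    = *-identityˡ _
  ⊛-identityˡ B (suc n) = begin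
    sumTo (suc n) (λ i → oneS i * B (suc n ∸ i))     ≈⟨ sumTo-suc n _ ⟩
    1# * B (suc n) + sumTo n (λ i → 0# * B (n ∸ i))  ≈⟨ +-cong (*-identityˡ _) (sumTo-≈0 n (λ i _ → zeroˡ _)) ⟩
    B (suc n) + 0#                                  ≈⟨ +-identityʳ _ ⟩
    B (suc n)                                       ∎

  module _ {U : Series} (U0≈0 : U 0 ≈ 0#) where

    powS-vanish : ∀ m n → n < m → powS U m n ≈ 0#
    powS-vanish (suc m) n (s≤s n≤m) = sumTo-≈0 n term
      where
      term : ∀ i → i ≤ n → U i * powS U m (n ∸ i) ≈ 0#
      term zero    _   = trans (*-congʳ U0≈0) (zeroˡ _)
      term (suc i) i≤n = trans (*-congˡ (powS-vanish m (n ∸ suc i)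
                                   (ℕₚ.<-≤-trans (ℕₚ.∸-monoʳ-< (s≤s z≤n) i≤n) n≤m))) (zeroʳ _)

    powS-+ : ∀ a c n → (powS U a ⊛ powS U c) n ≈ powS U (a ℕ.+ c) n
    powS-+ zero    c n = ⊛-identityˡ (powS U c) n
    powS-+ (suc a) c n = trans (⊛-assoc U (powS U a) (powS U c) n) (⊛-cong (λ _ → refl) (powS-+ a c) n)

    ∘S-extend : ∀ (A : Series) {i n} → i ≤ n → (A ∘S U) i ≈ sumTo n (λ m → A m * powS U m i)
    ∘S-extend A {i} {n} i≤n =
      sym (sumTo-extend i n _ i≤n (λ m i<m _ → trans (*-congˡ (powS-vanish m i i<m)) (zeroʳ _)))

    ⊛-∘S-expand : ∀ (A B : Series) n → ((A ∘S U) ⊛ (B ∘S U)) n ≈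
      sumTo n (λ a → sumTo n (λ c → (A a * B c) * powS U (a ℕ.+ c) n))
    ⊛-∘S-expand A B n = begin
      sumTo n (λ i → (A ∘S U) i * (B ∘S U) (n ∸ i))
        ≈⟨ sumTo-cong n (λ i i≤n → *-cong (∘S-extend A i≤n) (∘S-extend B (ℕₚ.m∸n≤m n i))) ⟩
      sumTo n (λ i → sumTo n (λ a → A a * powS U a i) * sumTo n (λ c → B c * powS U c (n ∸ i)))
        ≈⟨ sumTo-cong n (λ i _ → trans (sumTo-*-sumTo n n _ _)
             (sumTo-cong n (λ a _ → sumTo-cong n (λ c _ → *-CS.interchange _ _ _ _)))) ⟩
      sumTo n (λ i → sumTo n (λ a → sumTo n (λ c → (A a * B c) * (powS U a i * powS U c (n ∸ i)))))
        ≈⟨ trans (sumTo-swap n n _) (sumTo-cong n (λ a _ → sumTo-swap n n _)) ⟩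
      sumTo n (λ a → sumTo n (λ c → sumTo n (λ i → (A a * B c) * (powS U a i * powS U c (n ∸ i)))))
        ≈⟨ sumTo-cong n (λ a _ → sumTo-cong n (λ c _ →
             trans (sym (*-distribˡ-sumTo n _ _)) (*-congˡ (powS-+ a c n)))) ⟩
      sumTo n (λ a → sumTo n (λ c → (A a * B c) * powS U (a ℕ.+ c) n)) ∎

    ∘S-⊛-expand : ∀ (A B : Series) n → ((A ⊛ B) ∘S U) n ≈
      sumTo n (λ a → sumTo n (λ c → (A a * B c) * powS U (a ℕ.+ c) n))
    ∘S-⊛-expand A B n = begin
      sumTo n (λ m → sumTo m (λ a → A a * B (m ∸ a)) * powS U m n)
        ≈⟨ sumTo-cong n (λ m _ → *-distribʳ-sumTo m _ _) ⟩
      sumTo n (λ m → sumTo m (λ a → A a * B (m ∸ a) * powS U m n))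
        ≈⟨ sumTo-triangle n (λ a m → A a * B (m ∸ a) * powS U m n) ⟩
      sumTo n (λ a → sumTo (n ∸ a) (λ c → A a * B (a ℕ.+ c ∸ a) * powS U (a ℕ.+ c) n))
        ≈⟨ sumTo-cong n (λ a _ → sumTo-cong (n ∸ a) (λ c _ →
             *-congʳ (*-congˡ (reflexive (≡.cong B (ℕₚ.m+n∸m≡n a c)))))) ⟩
      sumTo n (λ a → sumTo (n ∸ a) (λ c → (A a * B c) * powS U (a ℕ.+ c) n))
        ≈⟨ sumTo-cong n (λ a a≤n → sym (sumTo-extend (n ∸ a) n _ (ℕₚ.m∸n≤m n a) (λ c n∸a<c _ →
             trans (*-congˡ (powS-vanish (a ℕ.+ c) n (n<a+c a≤n n∸a<c))) (zeroʳ _)))) ⟩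
      sumTo n (λ a → sumTo n (λ c → (A a * B c) * powS U (a ℕ.+ c) n)) ∎
      where
      n<a+c : ∀ {a c} → a ≤ n → n ∸ a < c → n < a ℕ.+ c
      n<a+c {a} a≤n n∸a<c = ≡.subst (_< a ℕ.+ _) (ℕₚ.m+[n∸m]≡n a≤n) (ℕₚ.+-monoʳ-< a n∸a<c)

    ∘S-⊛ : ∀ (A B : Series) n → ((A ⊛ B) ∘S U) n ≈ ((A ∘S U) ⊛ (B ∘S U)) n
    ∘S-⊛ A B n = trans (∘S-⊛-expand A B n) (sym (⊛-∘S-expand A B n))

  -- The exponential law

  natC-+ : ∀ m n → natC cring (m ℕ.+ n) ≈ natC cring m + natC cring n
  natC-+ zero    n = sym (+-identityˡ _)
  natC-+ (suc m) n = trans (+-congˡ (natC-+ m n)) (sym (+-assoc _ _ _))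

  natC-* : ∀ m n → natC cring (m ℕ.* n) ≈ natC cring m * natC cring n
  natC-* zero    n = sym (zeroˡ _)
  natC-* (suc m) n = begin
    natC cring (n ℕ.+ m ℕ.* n)                          ≈⟨ natC-+ n (m ℕ.* n) ⟩
    natC cring n + natC cring (m ℕ.* n)                 ≈⟨ +-cong (sym (*-identityˡ _)) (natC-* m n) ⟩
    1# * natC cring n + natC cring m * natC cring n     ≈⟨ sym (distribʳ _ _ _) ⟩
    (1# + natC cring m) * natC cring n                  ∎

  natC-!-*-invFact : ∀ m → natC cring (m !) * invFact m ≈ 1#
  natC-!-*-invFact m = proj₂ (inverse (natC cring (m !)) (charZero (m !) {{m ℕₚ.!≢0}}))

  natC-C-*-invFact : ∀ {m a} → a ≤ m → natC cring (m choose a) * invFact m ≈ invFact a * invFact (m ∸ a)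
  natC-C-*-invFact {m} {a} a≤m = begin
    X * I                                 ≈⟨ sym (*-identityʳ _) ⟩
    (X * I) * 1#                          ≈⟨ *-congˡ (sym (trans (*-cong (natC-!-*-invFact a) (natC-!-*-invFact (m ∸ a)))
                                                                 (*-identityˡ _))) ⟩
    (X * I) * ((Fa * Ia) * (Fb * Ib))     ≈⟨ *-congˡ (*-CS.interchange Fa Ia Fb Ib) ⟩
    (X * I) * ((Fa * Fb) * (Ia * Ib))     ≈⟨ sym (*-assoc _ _ _) ⟩
    (X * I) * (Fa * Fb) * (Ia * Ib)       ≈⟨ *-congʳ (*-CS.xy∙z≈xz∙y X I (Fa * Fb)) ⟩
    X * (Fa * Fb) * I * (Ia * Ib)         ≈⟨ *-congʳ (*-congʳ (sym (trans (natC-* (m choose a) _) (*-congˡ (natC-* (a !) _))))) ⟩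
    natC cring ((m choose a) ℕ.* (a ! ℕ.* (m ∸ a) !)) * I * (Ia * Ib)
                                          ≈⟨ *-congʳ (*-congʳ (reflexive (≡.cong (natC cring) C*!*!≡!))) ⟩
    natC cring (m !) * I * (Ia * Ib)      ≈⟨ *-congʳ (natC-!-*-invFact m) ⟩
    1# * (Ia * Ib)                        ≈⟨ *-identityˡ _ ⟩
    Ia * Ib                               ∎
    where
    X = natC cring (m choose a)
    I = invFact m
    Fa = natC cring (a !)
    Fb = natC cring ((m ∸ a) !)
    Ia = invFact a
    Ib = invFact (m ∸ a)
    C*!*!≡! : (m choose a) ℕ.* (a ! ℕ.* (m ∸ a) !) ≡ m !
    C*!*!≡! = ≡.trans (≡.cong (ℕ._* (a ! ℕ.* (m ∸ a) !)) (nCk≡n!/k![n-k]! a≤m))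
                      (ℕ÷.m/n*n≡m {{a ℕₚ.!* (m ∸ a) !≢0}} (k![n∸k]!∣n! a≤m))

  expTerm : ℕ → Carrier → Carrier
  expTerm m z = powC z m * invFact m

  private
    open Binomial commutativeSemiring using (binomialExpansion) renaming (theorem to binomialTheorem)
    open Exp semiring using (_^_)
    open Mult semiring using () renaming (_×_ to _·_)
    open RawMonoid +-rawMonoid using (sum)

    powC≈^ : ∀ z m → powC z m ≈ z ^ m
    powC≈^ z zero    = refl
    powC≈^ z (suc m) = *-congˡ (powC≈^ z m)

    ·≈natC-* : ∀ n z → n · z ≈ natC cring n * z
    ·≈natC-* zero    z = sym (zeroˡ z)
    ·≈natC-* (suc n) z = trans (+-cong (sym (*-identityˡ z)) (·≈natC-* n z)) (sym (distribʳ _ _ _))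

    sum≈sumTo : ∀ n (h : Fin (suc n) → Carrier) (h′ : ℕ → Carrier) → (∀ k → h k ≈ h′ (toℕ k)) →
      sum h ≈ sumTo n h′
    sum≈sumTo zero    h h′ eq = trans (+-identityʳ _) (eq Fin.zero)
    sum≈sumTo (suc n) h h′ eq =
      trans (+-cong (eq Fin.zero) (sum≈sumTo n (h ∘ Fin.suc) (h′ ∘ suc) (eq ∘ Fin.suc))) (sym (sumTo-suc n h′))

  expTerm-+ : ∀ x y m → expTerm m (x + y) ≈ ((λ a → expTerm a x) ⊛ (λ a → expTerm a y)) m
  expTerm-+ x y m = begin
    powC (x + y) m * invFact m
      ≈⟨ *-congʳ (trans (powC≈^ _ m) (binomialTheorem m x y)) ⟩
    binomialExpansion x y m * invFact m
      ≈⟨ *-congʳ (sum≈sumTo m _ _ (λ k → trans (·≈natC-* (m choose toℕ k) _)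
           (*-congˡ (*-cong (sym (powC≈^ x (toℕ k))) (sym (powC≈^ y (m ∸ toℕ k))))))) ⟩
    sumTo m (λ a → natC cring (m choose a) * (powC x a * powC y (m ∸ a))) * invFact m
      ≈⟨ *-distribʳ-sumTo m _ _ ⟩
    sumTo m (λ a → natC cring (m choose a) * (powC x a * powC y (m ∸ a)) * invFact m)
      ≈⟨ sumTo-cong m term ⟩
    sumTo m (λ a → expTerm a x * expTerm (m ∸ a) y) ∎
    where
    term : ∀ a → a ≤ m → natC cring (m choose a) * (powC x a * powC y (m ∸ a)) * invFact m ≈ expTerm a x * expTerm (m ∸ a) y
    term a a≤m = begin
      natC cring (m choose a) * (powC x a * powC y (m ∸ a)) * invFact m ≈⟨ *-CS.xy∙z≈xz∙y _ _ _ ⟩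
      natC cring (m choose a) * invFact m * (powC x a * powC y (m ∸ a)) ≈⟨ *-congʳ (natC-C-*-invFact a≤m) ⟩
      invFact a * invFact (m ∸ a) * (powC x a * powC y (m ∸ a))    ≈⟨ *-CS.interchange _ _ _ _ ⟩
      invFact a * powC x a * (invFact (m ∸ a) * powC y (m ∸ a))    ≈⟨ *-cong (*-comm _ _) (*-comm _ _) ⟩
      expTerm a x * expTerm (m ∸ a) y                             ∎

  expCoeff≈∘S : ∀ U z n → expCoeff U z n ≈ ((λ m → expTerm m z) ∘S U) n
  expCoeff≈∘S U z n = sumTo-cong n (λ m _ → sym (*-assoc _ _ _))

  expCoeff-+ : ∀ {U} → U 0 ≈ 0# → ∀ x y n → expCoeff U (x + y) n ≈ (expCoeff U x ⊛ expCoeff U y) n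
  expCoeff-+ {U} U0≈0 x y n = begin
    expCoeff U (x + y) n
      ≈⟨ expCoeff≈∘S U (x + y) n ⟩
    ((λ m → expTerm m (x + y)) ∘S U) n
      ≈⟨ sumTo-cong n (λ m _ → *-congʳ (expTerm-+ x y m)) ⟩
    (((λ m → expTerm m x) ⊛ (λ m → expTerm m y)) ∘S U) n
      ≈⟨ ∘S-⊛ U0≈0 _ _ n ⟩
    (((λ m → expTerm m x) ∘S U) ⊛ ((λ m → expTerm m y) ∘S U)) n
      ≈⟨ sym (⊛-cong (expCoeff≈∘S U x) (expCoeff≈∘S U y) n) ⟩
    (expCoeff U x ⊛ expCoeff U y) n ∎

  -- Polynomial families of binomial type

  IsConvolution : (q r w : ℕ → Carrier → Carrier) → Set (c ⊔ ℓ)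
  IsConvolution q r w = ∀ x y n → w n (x + y) ≈ ((λ i → q i x) ⊛ (λ i → r i y)) n

  module _ (D : ShefferData) where
    open ShefferData D using (fbar; fbar0; G; pbar; sbar)

    pbar-isConvolution : IsConvolution pbar pbar pbar
    pbar-isConvolution = expCoeff-+ fbar0

    sbar-isConvolution : IsConvolution pbar sbar sbar
    sbar-isConvolution x y n = begin
      (G ⊛ E (x + y)) n    ≈⟨ ⊛-cong {G} {G} (λ _ → refl) (pbar-isConvolution x y) n ⟩
      (G ⊛ (E x ⊛ E y)) n  ≈⟨ sym (⊛-assoc G (E x) (E y) n) ⟩
      ((G ⊛ E x) ⊛ E y) n  ≈⟨ ⊛-cong {B = E y} {E y} (⊛-comm G (E x)) (λ _ → refl) n ⟩
      ((E x ⊛ G) ⊛ E y) n  ≈⟨ ⊛-assoc (E x) G (E y) n ⟩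
      (E x ⊛ (G ⊛ E y)) n  ∎
      where
      E : Carrier → Series
      E = expCoeff fbar

  -- Digit matrices

  toeplitz : (ℕ → Carrier → Carrier) → Carrier → ℕ → ℕ → Carrier
  toeplitz q z j k with k ≤? j
  ... | yes _ = q (j ∸ k) z
  ... | no  _ = 0#

  toeplitz-≤ : ∀ q z {j k} → k ≤ j → toeplitz q z j k ≈ q (j ∸ k) z
  toeplitz-≤ q z {j} {k} k≤j with k ≤? j
  ... | yes _   = refl
  ... | no  k≰j = ⊥-elim (k≰j k≤j)

  toeplitz-≰ : ∀ q z {j k} → ¬ (k ≤ j) → toeplitz q z j k ≈ 0#
  toeplitz-≰ q z {j} {k} k≰j with k ≤? j
  ... | yes k≤j = ⊥-elim (k≰j k≤j)
  ... | no  _   = refl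

  toeplitz-⊠ : ∀ {q r w} → IsConvolution q r w → ∀ b j k z₁ z₂ → j < b →
    sumBelow b (λ l → toeplitz q z₁ j l * toeplitz r z₂ l k) ≈ toeplitz w (z₁ + z₂) j k
  toeplitz-⊠ {q} {r} {w} conv b j k z₁ z₂ j<b = byCases (k ≤? j)
    where
    byCases : Dec (k ≤ j) → sumBelow b (λ l → toeplitz q z₁ j l * toeplitz r z₂ l k) ≈ toeplitz w (z₁ + z₂) j k
    byCases (no k≰j) = trans (sumBelow-≈0 b (λ l _ → term l (l ≤? j))) (sym (toeplitz-≰ w _ k≰j))
      where
      term : ∀ l → Dec (l ≤ j) → toeplitz q z₁ j l * toeplitz r z₂ l k ≈ 0#
      term l (no  l≰j) = trans (*-congʳ (toeplitz-≰ q z₁ l≰j)) (zeroˡ _)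
      term l (yes l≤j) = trans (*-congˡ (toeplitz-≰ r z₂ (λ k≤l → k≰j (ℕₚ.≤-trans k≤l l≤j)))) (zeroʳ _)
    byCases (yes k≤j) = begin
      sumBelow b (λ l → toeplitz q z₁ j l * toeplitz r z₂ l k)
        ≈⟨ sumBelow-window b k j k≤j j<b
             (λ l l<k → trans (*-congˡ (toeplitz-≰ r z₂ (ℕₚ.<⇒≱ l<k))) (zeroʳ _))
             (λ l j<l → trans (*-congʳ (toeplitz-≰ q z₁ (ℕₚ.<⇒≱ j<l))) (zeroˡ _)) ⟩
      sumTo (j ∸ k) (λ i → toeplitz q z₁ j (k ℕ.+ i) * toeplitz r z₂ (k ℕ.+ i) k)
        ≈⟨ sumTo-cong (j ∸ k) (λ i i≤j∸k → trans (*-comm _ _)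
             (*-cong (trans (toeplitz-≤ r z₂ (ℕₚ.m≤m+n k i)) (reflexive (≡.cong (λ d → r d z₂) (ℕₚ.m+n∸m≡n k i))))
                     (trans (toeplitz-≤ q z₁ (k+i≤j i≤j∸k))
                            (reflexive (≡.cong (λ d → q d z₁) (≡.sym (ℕₚ.∸-+-assoc j k i))))))) ⟩
      ((λ i → r i z₂) ⊛ (λ i → q i z₁)) (j ∸ k)
        ≈⟨ ⊛-comm _ _ (j ∸ k) ⟩
      ((λ i → q i z₁) ⊛ (λ i → r i z₂)) (j ∸ k)
        ≈⟨ sym (conv z₁ z₂ (j ∸ k)) ⟩
      w (j ∸ k) (z₁ + z₂)
        ≈⟨ sym (toeplitz-≤ w (z₁ + z₂) k≤j) ⟩
      toeplitz w (z₁ + z₂) j k ∎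
      where
      k+i≤j : ∀ {i} → i ≤ j ∸ k → k ℕ.+ i ≤ j
      k+i≤j i≤j∸k = ≡.subst (_ ≤_) (ℕₚ.m+[n∸m]≡n k≤j) (ℕₚ.+-monoʳ-≤ k i≤j∸k)

  module _ (b : ℕ) .{{_ : NonZero b}} where

    -- Entry (j, k) of the Kronecker product of N one-digit Toeplitz matrices, one per base-b digit.
    kronToeplitz : (ℕ → Carrier → Carrier) → (N : ℕ) → (Fin N → Carrier) → ℕ → ℕ → Carrier
    kronToeplitz q zero    x j k = 1#
    kronToeplitz q (suc N) x j k =
      toeplitz q (x Fin.zero) (j % b) (k % b) * kronToeplitz q N (x ∘ Fin.suc) (j / b) (k / b)

    [m+n*b]%b≡m : ∀ {m} n → m < b → (m ℕ.+ n ℕ.* b) % b ≡ m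
    [m+n*b]%b≡m {m} n m<b = ≡.trans (ℕ÷.[m+kn]%n≡m%n m n b) (ℕ÷.m<n⇒m%n≡m m<b)

    [m+n*b]/b≡n : ∀ {m} n → m < b → (m ℕ.+ n ℕ.* b) / b ≡ n
    [m+n*b]/b≡n {m} n m<b =
      ≡.trans (ℕ÷.+-distrib-/ m (n ℕ.* b) no-carry) (≡.cong₂ ℕ._+_ (ℕ÷.m<n⇒m/n≡0 m<b) (ℕ÷.m*n/n≡m n b))
      where
      no-carry : m % b ℕ.+ (n ℕ.* b) % b < b
      no-carry = ≡.subst (_< b)
        (≡.sym (≡.trans (≡.cong₂ ℕ._+_ (ℕ÷.m<n⇒m%n≡m m<b) (ℕ÷.m*n%n≡0 n b)) (ℕₚ.+-identityʳ m))) m<b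

    m<b^[1+N]⇒m/b<b^N : ∀ N m → m < b ℕ.^ suc N → m / b < b ℕ.^ N
    m<b^[1+N]⇒m/b<b^N N m m<b^[1+N] = ℕ÷.m<n*o⇒m/o<n (≡.subst (m <_) (ℕₚ.*-comm b (b ℕ.^ N)) m<b^[1+N])

    ∸-noBorrow : ∀ j k → k % b ≤ j % b → k / b ≤ j / b →
      j ∸ k ≡ (j % b ∸ k % b) ℕ.+ (j / b ∸ k / b) ℕ.* b
    ∸-noBorrow j k k%b≤j%b k/b≤j/b = ≡.trans (≡.cong (_∸ k) j≡d+k) (ℕₚ.m+n∸n≡m _ k)
      where
      open Data.Nat.Solver.+-*-Solver using (solve; _:+_; _:*_; _:=_)
      j≡d+k : j ≡ ((j % b ∸ k % b) ℕ.+ (j / b ∸ k / b) ℕ.* b) ℕ.+ k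
      j≡d+k = ≡.trans (ℕ÷.m≡m%n+[m/n]*n j b)
        (≡.trans (≡.cong₂ (λ u v → u ℕ.+ v ℕ.* b) (≡.sym (ℕₚ.m+[n∸m]≡n k%b≤j%b)) (≡.sym (ℕₚ.m+[n∸m]≡n k/b≤j/b)))
        (≡.trans (solve 5 (λ k₀ d₀ k₁ d₁ b → (k₀ :+ d₀) :+ (k₁ :+ d₁) :* b := (d₀ :+ d₁ :* b) :+ (k₀ :+ k₁ :* b))
                          ≡.refl (k % b) (j % b ∸ k % b) (k / b) (j / b ∸ k / b) b)
                 (≡.cong ((j % b ∸ k % b) ℕ.+ (j / b ∸ k / b) ℕ.* b ℕ.+_) (≡.sym (ℕ÷.m≡m%n+[m/n]*n k b)))))

    kronToeplitz-digits : ∀ q N x j k → k ≤ j → Prec b N k j →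
      prodFin N (λ i → q (digit b (toℕ i) (j ∸ k)) (x i)) ≈ kronToeplitz q N x j k
    kronToeplitz-digits q zero    x j k k≤j k⪯j = refl
    kronToeplitz-digits q (suc N) x j k k≤j k⪯j = *-cong lowDigit highDigits
      where
      k%b≤j%b = k⪯j Fin.zero
      k/b≤j/b = ℕ÷./-monoˡ-≤ b k≤j
      d₀<b : j % b ∸ k % b < b
      d₀<b = ℕₚ.≤-<-trans (ℕₚ.m∸n≤m (j % b) (k % b)) (ℕ÷.m%n<n j b)
      lowDigit : q ((j ∸ k) % b) (x Fin.zero) ≈ toeplitz q (x Fin.zero) (j % b) (k % b)
      lowDigit = trans (reflexive (≡.cong (λ d → q d (x Fin.zero))
                   (≡.trans (≡.cong (_% b) (∸-noBorrow j k k%b≤j%b k/b≤j/b)) ([m+n*b]%b≡m (j / b ∸ k / b) d₀<b))))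
                   (sym (toeplitz-≤ q _ k%b≤j%b))
      highDigits : prodFin N (λ i → q (digit b (toℕ i) ((j ∸ k) / b)) (x (Fin.suc i))) ≈
                   kronToeplitz q N (x ∘ Fin.suc) (j / b) (k / b)
      highDigits rewrite ≡.trans (≡.cong (_/ b) (∸-noBorrow j k k%b≤j%b k/b≤j/b)) ([m+n*b]/b≡n (j / b ∸ k / b) d₀<b) =
        kronToeplitz-digits q N (x ∘ Fin.suc) (j / b) (k / b) k/b≤j/b (k⪯j ∘ Fin.suc)

    kronToeplitz-≈0 : ∀ q N x j k → j < b ℕ.^ N → k < b ℕ.^ N → ¬ (k ≤ j × Prec b N k j) →
      kronToeplitz q N x j k ≈ 0#
    kronToeplitz-≈0 q zero    x 0 0 (s≤s z≤n) (s≤s z≤n) ¬k⪯j = ⊥-elim (¬k⪯j (z≤n , λ ()))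
    kronToeplitz-≈0 q (suc N) x j k j<b^N k<b^N ¬k⪯j = byCases (k % b ≤? j % b)
      where
      byCases : Dec (k % b ≤ j % b) → kronToeplitz q (suc N) x j k ≈ 0#
      byCases (no  k%b≰j%b) = trans (*-congʳ (toeplitz-≰ q _ k%b≰j%b)) (zeroˡ _)
      byCases (yes k%b≤j%b) = trans (*-congˡ (kronToeplitz-≈0 q N (x ∘ Fin.suc) (j / b) (k / b)
                                   (m<b^[1+N]⇒m/b<b^N N j j<b^N) (m<b^[1+N]⇒m/b<b^N N k k<b^N) ¬k/b⪯j/b)) (zeroʳ _)
        where
        ¬k/b⪯j/b : ¬ (k / b ≤ j / b × Prec b N (k / b) (j / b))
        ¬k/b⪯j/b (k/b≤j/b , k/b⪯j/b) = ¬k⪯j (k≤j , k⪯j)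
          where
          k≤j : k ≤ j
          k≤j = ≡.subst₂ _≤_ (≡.sym (ℕ÷.m≡m%n+[m/n]*n k b)) (≡.sym (ℕ÷.m≡m%n+[m/n]*n j b))
                            (ℕₚ.+-mono-≤ k%b≤j%b (ℕₚ.*-monoˡ-≤ b k/b≤j/b))
          k⪯j : Prec b (suc N) k j
          k⪯j Fin.zero    = k%b≤j%b
          k⪯j (Fin.suc i) = k/b⪯j/b i

    digitMat≈kronToeplitz : ∀ q N x (j k : Fin (b ℕ.^ N)) → digitMat b N q x j k ≈ kronToeplitz q N x (toℕ j) (toℕ k)
    digitMat≈kronToeplitz q N x j k with (toℕ k ≤? toℕ j) ×-dec Prec? b N (toℕ k) (toℕ j)
    ... | yes (k≤j , k⪯j) = kronToeplitz-digits q N x (toℕ j) (toℕ k) k≤j k⪯j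
    ... | no  ¬k⪯j        = sym (kronToeplitz-≈0 q N x _ _ (toℕ<n j) (toℕ<n k) ¬k⪯j)

    module _ {q r w : ℕ → Carrier → Carrier} (conv : IsConvolution q r w) where

      -- Split the summation index as l = l₀ + l₁ b and use the mixed-product property of ⊗.
      kronToeplitz-⊠ : ∀ N x y j k →
        sumBelow (b ℕ.^ N) (λ l → kronToeplitz q N x j l * kronToeplitz r N y l k) ≈ kronToeplitz w N (x +V y) j k
      kronToeplitz-⊠ zero    x y j k = trans (+-identityʳ _) (*-identityˡ _)
      kronToeplitz-⊠ (suc N) x y j k = begin
        sumBelow (b ℕ.* b ℕ.^ N) h
          ≡⟨ ≡.cong (λ n → sumBelow n h) (ℕₚ.*-comm b (b ℕ.^ N)) ⟩
        sumBelow (b ℕ.^ N ℕ.* b) h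
          ≈⟨ sumBelow-* (b ℕ.^ N) b h ⟩
        sumBelow (b ℕ.^ N) (λ l₁ → sumBelow b (λ l₀ → h (l₀ ℕ.+ l₁ ℕ.* b)))
          ≈⟨ sumBelow-cong (b ℕ.^ N) (λ l₁ _ →
               trans (sumBelow-cong b (λ l₀ l₀<b → split l₀ l₁ l₀<b)) (sym (*-distribʳ-sumBelow b _ _))) ⟩
        sumBelow (b ℕ.^ N) (λ l₁ → sumBelow b (λ l₀ → Tq₀ l₀ * Tr₀ l₀) * (Tq l₁ * Tr l₁))
          ≈⟨ sumBelow-cong (b ℕ.^ N) (λ l₁ _ → *-congʳ (toeplitz-⊠ conv b (j % b) (k % b) _ _ (ℕ÷.m%n<n j b))) ⟩
        sumBelow (b ℕ.^ N) (λ l₁ → toeplitz w (x Fin.zero + y Fin.zero) (j % b) (k % b) * (Tq l₁ * Tr l₁))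
          ≈⟨ sym (*-distribˡ-sumBelow (b ℕ.^ N) _ _) ⟩
        toeplitz w (x Fin.zero + y Fin.zero) (j % b) (k % b) * sumBelow (b ℕ.^ N) (λ l₁ → Tq l₁ * Tr l₁)
          ≈⟨ *-congˡ (kronToeplitz-⊠ N (x ∘ Fin.suc) (y ∘ Fin.suc) (j / b) (k / b)) ⟩
        kronToeplitz w (suc N) (x +V y) j k ∎
        where
        h : ℕ → Carrier
        h l = kronToeplitz q (suc N) x j l * kronToeplitz r (suc N) y l k
        Tq₀ Tr₀ Tq Tr : ℕ → Carrier
        Tq₀ l₀ = toeplitz q (x Fin.zero) (j % b) l₀
        Tr₀ l₀ = toeplitz r (y Fin.zero) l₀ (k % b)
        Tq l₁ = kronToeplitz q N (x ∘ Fin.suc) (j / b) l₁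
        Tr l₁ = kronToeplitz r N (y ∘ Fin.suc) l₁ (k / b)
        split : ∀ l₀ l₁ → l₀ < b → h (l₀ ℕ.+ l₁ ℕ.* b) ≈ (Tq₀ l₀ * Tr₀ l₀) * (Tq l₁ * Tr l₁)
        split l₀ l₁ l₀<b rewrite [m+n*b]%b≡m l₁ l₀<b | [m+n*b]/b≡n l₁ l₀<b = *-CS.interchange _ _ _ _

      digitMat-⊠ : ∀ N x y → (digitMat b N q x ⊠ digitMat b N r y) ≈M digitMat b N w (x +V y)
      digitMat-⊠ N x y j k = begin
        (digitMat b N q x ⊠ digitMat b N r y) j k
          ≈⟨ ⊠≈sumBelow (b ℕ.^ N) (digitMat b N q x) (digitMat b N r y) j k
               (λ l → kronToeplitz q N x (toℕ j) l * kronToeplitz r N y l (toℕ k))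
               (λ l → *-cong (digitMat≈kronToeplitz q N x j l) (digitMat≈kronToeplitz r N y l k)) ⟩
        sumBelow (b ℕ.^ N) (λ l → kronToeplitz q N x (toℕ j) l * kronToeplitz r N y l (toℕ k))
          ≈⟨ kronToeplitz-⊠ N x y (toℕ j) (toℕ k) ⟩
        kronToeplitz w N (x +V y) (toℕ j) (toℕ k)
          ≈⟨ sym (digitMat≈kronToeplitz w N (x +V y) j k) ⟩
        digitMat b N w (x +V y) j k ∎

theorem2p4 : {c ℓ : Level} (K : CharZeroField c ℓ) (D : Sheffer.ShefferData K)
    (b : ℕ) .{{_ : NonZero b}} → 2 ≤ b → (N : ℕ)
    (x y : Fin N → CharZeroField.Carrier K) →
    Sheffer._≈M_ K (Sheffer._⊠_ K (Sheffer.PMat K D b N x) (Sheffer.SMat K D b N y))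
                   (Sheffer.SMat K D b N (Sheffer._+V_ K x y))
    × Sheffer._≈M_ K (Sheffer._⊠_ K (Sheffer.PMat K D b N x) (Sheffer.PMat K D b N y))
                     (Sheffer.PMat K D b N (Sheffer._+V_ K x y))
theorem2p4 K D b _ N x y =
  digitMat-⊠ K b (sbar-isConvolution K D) N x y , digitMat-⊠ K b (pbar-isConvolution K D) N x y
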